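{- Let $\Gamma$ be a context and $\Delta$ a derivative of $\Gamma$. Let $\Theta$ be a context such that the type $[\Gamma,\Xi]$ is inhabited for every variable $t^{[\Xi]}\in\{\Theta\}$. Then $\Theta\le^a\Delta$ implies $\Theta\le^a\Gamma$.
   Context: Simply typed $\lambda$-calculus over base type $0$; every type is uniquely $[B_1,\dots,B_m]:=B_1\to\cdots\to B_m\to0$. A context $\Gamma=x_1^{C_1},\dots,x_k^{C_k}$ is a finite list of distinct typed variables, $\{\Gamma\}$ its set, $[\Gamma]:=[C_1,\dots,C_k]$. A type is inhabited if there is a closed term of that type. A direct derivative of a context $\Delta$ is a context $\Delta,\Delta_k$ where some $F^A\in\{\Delta\}$ has $A\equiv[[\Delta_1],\dots,[\Delta_n]]$, $k\in\{1,\dots,n\}$, and the variables of $\Delta_k$ are fresh; the derivatives of $\Gamma$ are the contexts obtained from $\Gamma$ by finitely many (possibly zero) direct-derivative steps. Terms identified up to $\beta\eta$ ($=_{\beta\eta}$); $\Lambda^\Xi(A)$ = terms of type $A$ with free variables in $\{\Xi\}$. A substitution $\varrho$ from $\Gamma$ to $\Delta$ assigns $\varrho_c\in\Lambda^\Delta(C)$ to each $c^C\in\{\Gamma\}$; for a fresh context $\Xi$, $\varrho^\Xi$ is $\varrho$ on $\{\Gamma\}$ and the identity on $\{\Xi\}$. $\varrho$ is an atomic reduction if for every fresh $\Xi$, all $a^A,b^B\in\{\Xi,\Gamma\}$ with $A\equiv[A_1,\dots,A_n]$, $B\equiv[B_1,\dots,B_m]$, and all $M_i\in\Lambda^{\Xi,\Delta}(A_i)$,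 $N_i\in\Lambda^{\Xi,\Delta}(B_i)$: $\varrho^\Xi_aM_1\cdots M_n=_{\beta\eta}\varrho^\Xi_bN_1\cdots N_m$ implies $a=b$ and all $M_i=N_i$. $\Theta\le^a\Gamma$ means there is an atomic reduction from $\Theta$ to $\Gamma$. -}

module Defs where

open import Data.List using (List; []; _∷_; _++_; foldr)
open import Data.Product using (Σ; ∃; _×_; _,_)

-- Simple types over the base type 0 (written ι).

infixr 7 _⇒_
data Ty : Set where
  ι   : Ty
  _⇒_ : Ty → Ty → Ty

[_] : List Ty → Ty
[ Bs ] = foldr _⇒_ ι Bs

-- the unique list Bs with A ≡ [ Bs ]
args : Ty → List Ty
args ι       = []
args (A ⇒ B) = A ∷ args B

-- Contexts: lists of types, variables are de Bruijn indices
-- (so variables are automatically distinct; a "fresh" context Ξ is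
-- simply a list prepended to the context).

Ctx : Set
Ctx = List Ty

data Var : Ctx → Ty → Set where
  here  : ∀ {Γ A}   → Var (A ∷ Γ) A
  there : ∀ {Γ A B} → Var Γ A → Var (B ∷ Γ) A

data Tm (Γ : Ctx) : Ty → Set where
  var : ∀ {A}   → Var Γ A → Tm Γ A
  lam : ∀ {A B} → Tm (A ∷ Γ) B → Tm Γ (A ⇒ B)
  app : ∀ {A B} → Tm Γ (A ⇒ B) → Tm Γ A → Tm Γ B

Ren : Ctx → Ctx → Set
Ren Γ Δ = ∀ {A} → Var Γ A → Var Δ A

liftR : ∀ {Γ Δ B} → Ren Γ Δ → Ren (B ∷ Γ) (B ∷ Δ)
liftR ρ here      = here
liftR ρ (there x) = there (ρ x)

rename : ∀ {Γ Δ A} → Ren Γ Δ → Tm Γ A → Tm Δ A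
rename ρ (var x)   = var (ρ x)
rename ρ (lam t)   = lam (rename (liftR ρ) t)
rename ρ (app t u) = app (rename ρ t) (rename ρ u)

weaken : ∀ {Γ A B} → Tm Γ A → Tm (B ∷ Γ) A
weaken = rename there

Sub : Ctx → Ctx → Set
Sub Γ Δ = ∀ {C} → Var Γ C → Tm Δ C

liftS : ∀ {Γ Δ B} → Sub Γ Δ → Sub (B ∷ Γ) (B ∷ Δ)
liftS σ here      = var here
liftS σ (there x) = weaken (σ x)

subst : ∀ {Γ Δ A} → Sub Γ Δ → Tm Γ A → Tm Δ A
subst σ (var x)   = σ x
subst σ (lam t)   = lam (subst (liftS σ) t)
subst σ (app t u) = app (subst σ t) (subst σ u)

sub₀ : ∀ {Γ A} → Tm Γ A → Sub (A ∷ Γ) Γ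
sub₀ u here      = u
sub₀ u (there x) = var x

_[_]₀ : ∀ {Γ A B} → Tm (A ∷ Γ) B → Tm Γ A → Tm Γ B
t [ u ]₀ = subst (sub₀ u) t

infix 4 _=βη_
data _=βη_ {Γ : Ctx} : ∀ {A} → Tm Γ A → Tm Γ A → Set where
  ≈refl  : ∀ {A} {t : Tm Γ A} → t =βη t
  ≈sym   : ∀ {A} {t u : Tm Γ A} → t =βη u → u =βη t
  ≈trans : ∀ {A} {t u v : Tm Γ A} → t =βη u → u =βη v → t =βη v
  ≈lam   : ∀ {A B} {t u : Tm (A ∷ Γ) B} → t =βη u → lam t =βη lam u
  ≈app   : ∀ {A B} {t t′ : Tm Γ (A ⇒ B)} {u u′ : Tm Γ A} →
           t =βη t′ → u =βη u′ → app t u =βη app t′ u′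
  β      : ∀ {A B} (t : Tm (A ∷ Γ) B) (u : Tm Γ A) →
           app (lam t) u =βη t [ u ]₀
  η      : ∀ {A B} (t : Tm Γ (A ⇒ B)) →
           t =βη lam (app (weaken t) (var here))

data Args (Γ : Ctx) : List Ty → Set where
  []  : Args Γ []
  _∷_ : ∀ {A As} → Tm Γ A → Args Γ As → Args Γ (A ∷ As)

infix 4 _=βη*_
data _=βη*_ {Γ : Ctx} : ∀ {As} → Args Γ As → Args Γ As → Set where
  []  : [] =βη* []
  _∷_ : ∀ {A As} {M N : Tm Γ A} {Ms Ns : Args Γ As} →
        M =βη N → Ms =βη* Ns → (M ∷ Ms) =βη* (N ∷ Ns)

apps : ∀ {Γ A} → Tm Γ A → Args Γ (args A) → Tm Γ ι
apps {A = ι}     t []       = t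
apps {A = A ⇒ B} t (M ∷ Ms) = apps (app t M) Ms

data SameSpine {Ψ Φ : Ctx} {A : Ty} (a : Var Ψ A) (Ms : Args Φ (args A)) :
               ∀ {B} → Var Ψ B → Args Φ (args B) → Set where
  same : ∀ {Ns} → Ms =βη* Ns → SameSpine a Ms a Ns

-- ϱ^Ξ : substitution from Ξ,Γ to Ξ,Δ, identity on Ξ and ϱ on Γ

extSub : ∀ {Γ Δ} (Ξ : Ctx) → Sub Γ Δ → Sub (Ξ ++ Γ) (Ξ ++ Δ)
extSub []      ϱ = ϱ
extSub (X ∷ Ξ) ϱ = liftS (extSub Ξ ϱ)

IsAtomic : ∀ {Γ Δ} → Sub Γ Δ → Set
IsAtomic {Γ} {Δ} ϱ =
  ∀ (Ξ : Ctx) {A B} (a : Var (Ξ ++ Γ) A) (b : Var (Ξ ++ Γ) B)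
    (Ms : Args (Ξ ++ Δ) (args A)) (Ns : Args (Ξ ++ Δ) (args B)) →
    apps (extSub Ξ ϱ a) Ms =βη apps (extSub Ξ ϱ b) Ns →
    SameSpine a Ms b Ns

infix 4 _≤ᵃ_
_≤ᵃ_ : Ctx → Ctx → Set
Θ ≤ᵃ Γ = Σ (Sub Θ Γ) IsAtomic

Inhabited : Ty → Set
Inhabited A = Tm [] A

-- Δ,Δₖ with F^A ∈ Δ, A ≡ [[Δ₁],…,[Δₙ]], [Δₖ] = k-th argument type of A,
-- so Δₖ = args (k-th argument type).
data Derivative (Γ : Ctx) : Ctx → Set where
  done : Derivative Γ Γ
  step : ∀ {Δ A Aₖ} → Derivative Γ Δ → Var Δ A → Var (args A) Aₖ →
         Derivative Γ (Δ ++ args Aₖ)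

-- It suffices to pass through one direct derivative Γ,Δₖ, where F^A ∈ Γ and
-- A ≡ [[Δ₁],…,[Δₙ]], and to iterate. Given an atomic ϱ from Θ to Γ,Δₖ, send t^T ∈ Θ to
--   σ t := λx⃗. F d₁ ⋯ (λy⃗. ϱ t x⃗) ⋯ dₙ,
-- i.e. put ϱ t, abstracted over the variables y⃗ of Δₖ, in the k-th argument of F
-- and fill the other arguments with terms dᵢ built from the inhabitant of
-- [Γ,Xs], where T ≡ [Xs]. If σ^Ξ a M⃗ =βη σ^Ξ b N⃗, normalisation shows that both sides have
-- the same head variable and βη-equal arguments. So a head from Ξ never meets F,
-- and two heads from Θ have equal k-th arguments of F, whence ϱ^Ξ t M⃗ =βη ϱ^Ξ s N⃗
-- in the context Ξ,Γ,Δₖ. Atomicity of ϱ gives t = s and M⃗ =βη N⃗ there, and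
-- substituting inhabitants for the variables of Δₖ brings this back to Ξ,Γ.

module Submission where

open import Defs
open import Data.List using (List; []; _∷_; _++_)
open import Data.Unit using (⊤; tt)
open import Data.Empty using (⊥; ⊥-elim)
open import Data.Product using (Σ; _×_; _,_; proj₁; proj₂)
open import Relation.Binary.PropositionalEquality using (_≡_; refl; sym; trans; cong; cong₂; module ≡-Reasoning)

-- Renaming and substitution

infix 4 _≗ʳ_ _≗ˢ_
_≗ʳ_ : ∀ {Γ Δ} → Ren Γ Δ → Ren Γ Δ → Set
r ≗ʳ s = ∀ {A} (x : Var _ A) → r x ≡ s x

_≗ˢ_ : ∀ {Γ Δ} → Sub Γ Δ → Sub Γ Δ → Set
σ ≗ˢ τ = ∀ {A} (x : Var _ A) → σ x ≡ τ x

liftR-cong : ∀ {Γ Δ B} {r s : Ren Γ Δ} → r ≗ʳ s → liftR {B = B} r ≗ʳ liftR s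
liftR-cong e here      = refl
liftR-cong e (there x) = cong there (e x)

liftR-id : ∀ {Γ B} {r : Ren Γ Γ} → r ≗ʳ (λ x → x) → liftR {B = B} r ≗ʳ (λ x → x)
liftR-id e here      = refl
liftR-id e (there x) = cong there (e x)

rename-cong : ∀ {Γ Δ A} {r s : Ren Γ Δ} → r ≗ʳ s → (t : Tm Γ A) → rename r t ≡ rename s t
rename-cong e (var x)   = cong var (e x)
rename-cong e (lam t)   = cong lam (rename-cong (liftR-cong e) t)
rename-cong e (app t u) = cong₂ app (rename-cong e t) (rename-cong e u)

rename-id : ∀ {Γ A} {r : Ren Γ Γ} → r ≗ʳ (λ x → x) → (t : Tm Γ A) → rename r t ≡ t
rename-id e (var x)   = cong var (e x)
rename-id e (lam t)   = cong lam (rename-id (liftR-id e) t)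
rename-id e (app t u) = cong₂ app (rename-id e t) (rename-id e u)

rename-rename : ∀ {Γ Δ Ψ A} (r : Ren Γ Δ) (r′ : Ren Δ Ψ) (t : Tm Γ A) →
                rename r′ (rename r t) ≡ rename (λ x → r′ (r x)) t
rename-rename r r′ (var x)   = refl
rename-rename r r′ (lam t)   =
  cong lam (trans (rename-rename (liftR r) (liftR r′) t)
                  (rename-cong (λ { here → refl ; (there x) → refl }) t))
rename-rename r r′ (app t u) = cong₂ app (rename-rename r r′ t) (rename-rename r r′ u)

rename-weaken : ∀ {Γ Δ A B} (r : Ren Γ Δ) (t : Tm Γ A) →
                rename (liftR {B = B} r) (weaken t) ≡ weaken (rename r t)
rename-weaken r t = trans (rename-rename there (liftR r) t) (sym (rename-rename r there t))

liftS-cong : ∀ {Γ Δ B} {σ τ : Sub Γ Δ} → σ ≗ˢ τ → liftS {B = B} σ ≗ˢ liftS τ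
liftS-cong e here      = refl
liftS-cong e (there x) = cong weaken (e x)

subst-cong : ∀ {Γ Δ A} {σ τ : Sub Γ Δ} → σ ≗ˢ τ → (t : Tm Γ A) → subst σ t ≡ subst τ t
subst-cong e (var x)   = e x
subst-cong e (lam t)   = cong lam (subst-cong (liftS-cong e) t)
subst-cong e (app t u) = cong₂ app (subst-cong e t) (subst-cong e u)

rename-subst : ∀ {Γ Δ Ψ A} (σ : Sub Γ Δ) (r : Ren Δ Ψ) (t : Tm Γ A) →
               rename r (subst σ t) ≡ subst (λ x → rename r (σ x)) t
rename-subst σ r (var x)   = refl
rename-subst σ r (lam t)   =
  cong lam (trans (rename-subst (liftS σ) (liftR r) t)
                  (subst-cong (λ { here → refl ; (there x) → rename-weaken r (σ x) }) t))
rename-subst σ r (app t u) = cong₂ app (rename-subst σ r t) (rename-subst σ r u)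

subst-rename : ∀ {Γ Δ Ψ A} (r : Ren Γ Δ) (σ : Sub Δ Ψ) (t : Tm Γ A) →
               subst σ (rename r t) ≡ subst (λ x → σ (r x)) t
subst-rename r σ (var x)   = refl
subst-rename r σ (lam t)   =
  cong lam (trans (subst-rename (liftR r) (liftS σ) t)
                  (subst-cong (λ { here → refl ; (there x) → refl }) t))
subst-rename r σ (app t u) = cong₂ app (subst-rename r σ t) (subst-rename r σ u)

subst-weaken : ∀ {Γ Δ A B} (σ : Sub Γ Δ) (t : Tm Γ A) →
               subst (liftS {B = B} σ) (weaken t) ≡ weaken (subst σ t)
subst-weaken σ t = trans (subst-rename there (liftS σ) t) (sym (rename-subst σ there t))

subst-subst : ∀ {Γ Δ Ψ A} (σ : Sub Γ Δ) (σ′ : Sub Δ Ψ) (t : Tm Γ A) →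
              subst σ′ (subst σ t) ≡ subst (λ x → subst σ′ (σ x)) t
subst-subst σ σ′ (var x)   = refl
subst-subst σ σ′ (lam t)   =
  cong lam (trans (subst-subst (liftS σ) (liftS σ′) t)
                  (subst-cong (λ { here → refl ; (there x) → subst-weaken σ′ (σ x) }) t))
subst-subst σ σ′ (app t u) = cong₂ app (subst-subst σ σ′ t) (subst-subst σ σ′ u)

subst-id : ∀ {Γ A} {σ : Sub Γ Γ} → σ ≗ˢ var → (t : Tm Γ A) → subst σ t ≡ t
subst-id e (var x)   = e x
subst-id e (lam t)   = cong lam (subst-id (λ { here → refl ; (there x) → cong weaken (e x) }) t)
subst-id e (app t u) = cong₂ app (subst-id e t) (subst-id e u)

subst-sub₀-weaken : ∀ {Γ A B} (u : Tm Γ B) (t : Tm Γ A) → subst (sub₀ u) (weaken t) ≡ t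
subst-sub₀-weaken u t = trans (subst-rename there (sub₀ u) t) (subst-id (λ _ → refl) t)

rename-as-subst : ∀ {Γ Δ A} (r : Ren Γ Δ) (t : Tm Γ A) → rename r t ≡ subst (λ x → var (r x)) t
rename-as-subst r (var x)   = refl
rename-as-subst r (lam t)   =
  cong lam (trans (rename-as-subst (liftR r) t)
                  (subst-cong (λ { here → refl ; (there x) → refl }) t))
rename-as-subst r (app t u) = cong₂ app (rename-as-subst r t) (rename-as-subst r u)

≡⇒=βη : ∀ {Γ A} {t u : Tm Γ A} → t ≡ u → t =βη u
≡⇒=βη refl = ≈refl

subst-βη : ∀ {Γ Δ A} (σ : Sub Γ Δ) {t u : Tm Γ A} → t =βη u → subst σ t =βη subst σ u
subst-βη σ ≈refl        = ≈refl
subst-βη σ (≈sym p)     = ≈sym (subst-βη σ p)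
subst-βη σ (≈trans p q) = ≈trans (subst-βη σ p) (subst-βη σ q)
subst-βη σ (≈lam p)     = ≈lam (subst-βη (liftS σ) p)
subst-βη σ (≈app p q)   = ≈app (subst-βη σ p) (subst-βη σ q)
subst-βη σ (β t u)      =
  ≈trans (β (subst (liftS σ) t) (subst σ u)) (≡⇒=βη (begin
    subst (sub₀ (subst σ u)) (subst (liftS σ) t)
      ≡⟨ subst-subst (liftS σ) (sub₀ (subst σ u)) t ⟩
    subst (λ x → subst (sub₀ (subst σ u)) (liftS σ x)) t
      ≡⟨ subst-cong (λ { here → refl ; (there x) → subst-sub₀-weaken (subst σ u) (σ x) }) t ⟩
    subst (λ x → subst σ (sub₀ u x)) t
      ≡⟨ sym (subst-subst (sub₀ u) σ t) ⟩
    subst σ (subst (sub₀ u) t) ∎))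
  where open ≡-Reasoning
subst-βη σ (η t)        =
  ≈trans (η (subst σ t))
         (≡⇒=βη (cong (λ s → lam (app s (var here))) (sym (subst-weaken σ t))))

rename-βη : ∀ {Γ Δ A} (r : Ren Γ Δ) {t u : Tm Γ A} → t =βη u → rename r t =βη rename r u
rename-βη r {t} {u} p =
  ≈trans (≡⇒=βη (rename-as-subst r t))
         (≈trans (subst-βη _ p) (≡⇒=βη (sym (rename-as-subst r u))))

-- Normalisation by evaluation

mutual
  data Ne (Γ : Ctx) : Ty → Set where
    var : ∀ {A} → Var Γ A → Ne Γ A
    app : ∀ {A B} → Ne Γ (A ⇒ B) → Nf Γ A → Ne Γ B

  data Nf (Γ : Ctx) : Ty → Set where
    ne  : Ne Γ ι → Nf Γ ι
    lam : ∀ {A B} → Nf (A ∷ Γ) B → Nf Γ (A ⇒ B)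

mutual
  renNe : ∀ {Γ Δ A} → Ren Γ Δ → Ne Γ A → Ne Δ A
  renNe r (var x)   = var (r x)
  renNe r (app n m) = app (renNe r n) (renNf r m)

  renNf : ∀ {Γ Δ A} → Ren Γ Δ → Nf Γ A → Nf Δ A
  renNf r (ne n)  = ne (renNe r n)
  renNf r (lam m) = lam (renNf (liftR r) m)

mutual
  renNe-cong : ∀ {Γ Δ A} {r s : Ren Γ Δ} → r ≗ʳ s → (n : Ne Γ A) → renNe r n ≡ renNe s n
  renNe-cong e (var x)   = cong var (e x)
  renNe-cong e (app n m) = cong₂ app (renNe-cong e n) (renNf-cong e m)

  renNf-cong : ∀ {Γ Δ A} {r s : Ren Γ Δ} → r ≗ʳ s → (n : Nf Γ A) → renNf r n ≡ renNf s n
  renNf-cong e (ne n)  = cong ne (renNe-cong e n)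
  renNf-cong e (lam m) = cong lam (renNf-cong (liftR-cong e) m)

mutual
  renNe-id : ∀ {Γ A} {r : Ren Γ Γ} → r ≗ʳ (λ x → x) → (n : Ne Γ A) → renNe r n ≡ n
  renNe-id e (var x)   = cong var (e x)
  renNe-id e (app n m) = cong₂ app (renNe-id e n) (renNf-id e m)

  renNf-id : ∀ {Γ A} {r : Ren Γ Γ} → r ≗ʳ (λ x → x) → (n : Nf Γ A) → renNf r n ≡ n
  renNf-id e (ne n)  = cong ne (renNe-id e n)
  renNf-id e (lam m) = cong lam (renNf-id (liftR-id e) m)

mutual
  renNe-renNe : ∀ {Γ Δ Ψ A} (r : Ren Γ Δ) (r′ : Ren Δ Ψ) (n : Ne Γ A) →
                renNe r′ (renNe r n) ≡ renNe (λ x → r′ (r x)) n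
  renNe-renNe r r′ (var x)   = refl
  renNe-renNe r r′ (app n m) = cong₂ app (renNe-renNe r r′ n) (renNf-renNf r r′ m)

  renNf-renNf : ∀ {Γ Δ Ψ A} (r : Ren Γ Δ) (r′ : Ren Δ Ψ) (n : Nf Γ A) →
                renNf r′ (renNf r n) ≡ renNf (λ x → r′ (r x)) n
  renNf-renNf r r′ (ne n)  = cong ne (renNe-renNe r r′ n)
  renNf-renNf r r′ (lam m) =
    cong lam (trans (renNf-renNf (liftR r) (liftR r′) m)
                    (renNf-cong (λ { here → refl ; (there x) → refl }) m))

mutual
  embNe : ∀ {Γ A} → Ne Γ A → Tm Γ A
  embNe (var x)   = var x
  embNe (app n m) = app (embNe n) (embNf m)

  embNf : ∀ {Γ A} → Nf Γ A → Tm Γ A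
  embNf (ne n)  = embNe n
  embNf (lam m) = lam (embNf m)

mutual
  rename-embNe : ∀ {Γ Δ A} (r : Ren Γ Δ) (n : Ne Γ A) → rename r (embNe n) ≡ embNe (renNe r n)
  rename-embNe r (var x)   = refl
  rename-embNe r (app n m) = cong₂ app (rename-embNe r n) (rename-embNf r m)

  rename-embNf : ∀ {Γ Δ A} (r : Ren Γ Δ) (n : Nf Γ A) → rename r (embNf n) ≡ embNf (renNf r n)
  rename-embNf r (ne n)  = rename-embNe r n
  rename-embNf r (lam m) = cong lam (rename-embNf (liftR r) m)

Val : Ctx → Ty → Set
Val Γ ι       = Ne Γ ι
Val Γ (A ⇒ B) = ∀ {Δ} → Ren Γ Δ → Val Δ A → Val Δ B

renVal : ∀ {Γ Δ} A → Ren Γ Δ → Val Γ A → Val Δ A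
renVal ι       r n = renNe r n
renVal (A ⇒ B) r f = λ r′ v → f (λ x → r′ (r x)) v

Env : Ctx → Ctx → Set
Env Γ Δ = ∀ {A} → Var Γ A → Val Δ A

renEnv : ∀ {Γ Δ Ψ} → Ren Δ Ψ → Env Γ Δ → Env Γ Ψ
renEnv r ρ {A} x = renVal A r (ρ x)

_,,_ : ∀ {Γ Δ A} → Env Γ Δ → Val Δ A → Env (A ∷ Γ) Δ
(ρ ,, v) here      = v
(ρ ,, v) (there x) = ρ x

eval : ∀ {Γ Δ A} → Tm Γ A → Env Γ Δ → Val Δ A
eval (var x)   ρ = ρ x
eval (lam t)   ρ = λ r v → eval t (renEnv r ρ ,, v)
eval (app t u) ρ = eval t ρ (λ x → x) (eval u ρ)

mutual
  reflect : ∀ {Γ} A → Ne Γ A → Val Γ A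
  reflect ι       n = n
  reflect (A ⇒ B) n = λ r v → reflect B (app (renNe r n) (reify A v))

  reify : ∀ {Γ} A → Val Γ A → Nf Γ A
  reify ι       n = ne n
  reify (A ⇒ B) f = lam (reify B (f there (reflect A (var here))))

idEnv : ∀ {Γ} → Env Γ Γ
idEnv {A = A} x = reflect A (var x)

nf : ∀ {Γ A} → Tm Γ A → Nf Γ A
nf {A = A} t = reify A (eval t idEnv)

-- Values of function type are Kripke functions, so equality of
-- values is a Kripke partial equivalence under which only uniform values
-- (those commuting with renaming) are related to themselves.

mutual
  EqV : ∀ {Γ} A → Val Γ A → Val Γ A → Set
  EqV ι       n m = n ≡ m
  EqV {Γ} (A ⇒ B) f g =
    ∀ {Δ} (r : Ren Γ Δ) {v w} → Uniform A v → Uniform A w → EqV A v w → EqV B (f r v) (g r w)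

  Uniform : ∀ {Γ} A → Val Γ A → Set
  Uniform ι       n = ⊤
  Uniform {Γ} (A ⇒ B) f =
    (∀ {Δ} (r : Ren Γ Δ) v → Uniform A v → Uniform B (f r v)) ×
    EqV (A ⇒ B) f f ×
    (∀ {Δ Ψ} (r : Ren Γ Δ) (r′ : Ren Δ Ψ) v → Uniform A v →
       EqV B (renVal B r′ (f r v)) (f (λ x → r′ (r x)) (renVal A r′ v)))

Uniform⇒EqV-refl : ∀ {Γ} A {v : Val Γ A} → Uniform A v → EqV A v v
Uniform⇒EqV-refl ι       _ = refl
Uniform⇒EqV-refl (A ⇒ B) u = proj₁ (proj₂ u)

mutual
  EqV-sym : ∀ {Γ} A {v w : Val Γ A} → EqV A v w → EqV A w v
  EqV-sym ι       p = sym p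
  EqV-sym (A ⇒ B) p r uv uw q = EqV-sym B (p r uw uv (EqV-sym A q))

  EqV-trans : ∀ {Γ} A {u v w : Val Γ A} → EqV A u v → EqV A v w → EqV A u w
  EqV-trans ι       p q = trans p q
  EqV-trans (A ⇒ B) p q r uu uv e = EqV-trans B (p r uu uv e) (q r uv uv (Uniform⇒EqV-refl A uv))

EqV-ren : ∀ {Γ Δ} A (r : Ren Γ Δ) {v w : Val Γ A} → EqV A v w → EqV A (renVal A r v) (renVal A r w)
EqV-ren ι       r p    = cong (renNe r) p
EqV-ren (A ⇒ B) r p r′ = p (λ x → r′ (r x))

renVal-renVal : ∀ {Γ Δ Ψ} A (r : Ren Γ Δ) (r′ : Ren Δ Ψ) {v w : Val Γ A} → EqV A v w →
                EqV A (renVal A r′ (renVal A r v)) (renVal A (λ x → r′ (r x)) w)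
renVal-renVal ι       r r′ {v} refl = renNe-renNe r r′ v
renVal-renVal (A ⇒ B) r r′ p r″     = p _

renVal-id : ∀ {Γ} A {v w : Val Γ A} → EqV A v w → EqV A (renVal A (λ x → x) v) w
renVal-id ι {v} refl = renNe-id (λ _ → refl) v
renVal-id (A ⇒ B) p  = p

Uniform-ren : ∀ {Γ Δ} A (r : Ren Γ Δ) {v : Val Γ A} → Uniform A v → Uniform A (renVal A r v)
Uniform-ren ι       r u                   = tt
Uniform-ren (A ⇒ B) r (app-uni , self , nat) =
  (λ r′ → app-uni _) , (λ r′ → self _) , (λ r′ → nat _)

mutual
  reify-cong : ∀ {Γ} A {v w : Val Γ A} → EqV A v w → reify A v ≡ reify A w
  reify-cong ι       p = cong ne p
  reify-cong (A ⇒ B) p =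
    cong lam (reify-cong B (p there (Uniform-reflect A _) (Uniform-reflect A _) (reflect-cong A refl)))

  reflect-cong : ∀ {Γ} A {n m : Ne Γ A} → n ≡ m → EqV A (reflect A n) (reflect A m)
  reflect-cong ι       p = p
  reflect-cong (A ⇒ B) refl r uv uw q = reflect-cong B (cong (app _) (reify-cong A q))

  Uniform-reflect : ∀ {Γ} A (n : Ne Γ A) → Uniform A (reflect A n)
  Uniform-reflect ι       n = tt
  Uniform-reflect (A ⇒ B) n =
    (λ r v _ → Uniform-reflect B _) ,
    reflect-cong (A ⇒ B) refl ,
    (λ r r′ v uv → EqV-trans B (renVal-reflect B r′ _)
       (reflect-cong B (cong₂ app (renNe-renNe r r′ n) (sym (reify-ren A r′ uv)))))

  renVal-reflect : ∀ {Γ Δ} A (r : Ren Γ Δ) (n : Ne Γ A) →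
                   EqV A (renVal A r (reflect A n)) (reflect A (renNe r n))
  renVal-reflect ι       r n = refl
  renVal-reflect (A ⇒ B) r n r′ uv uw q =
    reflect-cong B (cong₂ app (sym (renNe-renNe r r′ n)) (reify-cong A q))

  reify-ren : ∀ {Γ Δ} A (r : Ren Γ Δ) {v : Val Γ A} → Uniform A v →
              reify A (renVal A r v) ≡ renNf r (reify A v)
  reify-ren ι       r u = refl
  reify-ren (A ⇒ B) r (app-uni , self , nat) = cong lam (sym (trans
    (sym (reify-ren B (liftR r) (app-uni there _ x-uni)))
    (reify-cong B (EqV-trans B (nat there (liftR r) _ x-uni)
      (self _ (Uniform-ren A (liftR r) x-uni) (Uniform-reflect A _)
              (renVal-reflect A (liftR r) (var here)))))))
    where x-uni = Uniform-reflect A (var here)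

EqEnv : ∀ {Γ Δ} → Env Γ Δ → Env Γ Δ → Set
EqEnv {Γ} ρ ρ′ = ∀ {A} (x : Var Γ A) → EqV A (ρ x) (ρ′ x)

UniformEnv : ∀ {Γ Δ} → Env Γ Δ → Set
UniformEnv {Γ} ρ = ∀ {A} (x : Var Γ A) → Uniform A (ρ x)

UniformEnv-,, : ∀ {Γ Δ A} {ρ : Env Γ Δ} {v : Val Δ A} →
                UniformEnv ρ → Uniform A v → UniformEnv (ρ ,, v)
UniformEnv-,, u uv here      = uv
UniformEnv-,, u uv (there x) = u x

EqEnv-,, : ∀ {Γ Δ A} {ρ ρ′ : Env Γ Δ} {v w : Val Δ A} →
           EqEnv ρ ρ′ → EqV A v w → EqEnv (ρ ,, v) (ρ′ ,, w)
EqEnv-,, e q here      = q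
EqEnv-,, e q (there x) = e x

UniformEnv-ren : ∀ {Γ Δ Ψ} {ρ : Env Γ Δ} (r : Ren Δ Ψ) → UniformEnv ρ → UniformEnv (renEnv r ρ)
UniformEnv-ren r u {A} x = Uniform-ren A r (u x)

EqEnv-ren : ∀ {Γ Δ Ψ} {ρ ρ′ : Env Γ Δ} (r : Ren Δ Ψ) → EqEnv ρ ρ′ → EqEnv (renEnv r ρ) (renEnv r ρ′)
EqEnv-ren r e {A} x = EqV-ren A r (e x)

EqEnv-refl : ∀ {Γ Δ} {ρ : Env Γ Δ} → UniformEnv ρ → EqEnv ρ ρ
EqEnv-refl u {A} x = Uniform⇒EqV-refl A (u x)

mutual
  eval-cong : ∀ {Γ Δ A} (t : Tm Γ A) {ρ ρ′ : Env Γ Δ} →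
              UniformEnv ρ → UniformEnv ρ′ → EqEnv ρ ρ′ → EqV A (eval t ρ) (eval t ρ′)
  eval-cong (var x)   u u′ e = e x
  eval-cong (lam t)   u u′ e r uv uw q =
    eval-cong t (UniformEnv-,, (UniformEnv-ren r u) uv) (UniformEnv-,, (UniformEnv-ren r u′) uw)
                (EqEnv-,, (EqEnv-ren r e) q)
  eval-cong (app t s) u u′ e =
    eval-cong t u u′ e (λ x → x) (eval-Uniform s u) (eval-Uniform s u′) (eval-cong s u u′ e)

  eval-Uniform : ∀ {Γ Δ A} (t : Tm Γ A) {ρ : Env Γ Δ} → UniformEnv ρ → Uniform A (eval t ρ)
  eval-Uniform (var x)   u = u x
  eval-Uniform (app t s) u = proj₁ (eval-Uniform t u) (λ x → x) _ (eval-Uniform s u)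
  eval-Uniform {A = A ⇒ B} (lam t) u =
    (λ r v uv → eval-Uniform t (UniformEnv-,, (UniformEnv-ren r u) uv)) ,
    eval-cong (lam t) u u (EqEnv-refl u) ,
    λ r r′ v uv → EqV-trans B (renVal-eval t (UniformEnv-,, (UniformEnv-ren r u) uv) r′)
      (eval-cong t (UniformEnv-ren r′ (UniformEnv-,, (UniformEnv-ren r u) uv))
                   (UniformEnv-,, (UniformEnv-ren _ u) (Uniform-ren A r′ uv))
        λ { here → Uniform⇒EqV-refl A (Uniform-ren A r′ uv)
          ; {C} (there x) → renVal-renVal C r r′ (Uniform⇒EqV-refl C (u x)) })

  renVal-eval : ∀ {Γ Δ Ψ A} (t : Tm Γ A) {ρ : Env Γ Δ} → UniformEnv ρ → (r : Ren Δ Ψ) →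
                EqV A (renVal A r (eval t ρ)) (eval t (renEnv r ρ))
  renVal-eval {A = A} (var x) u r = Uniform⇒EqV-refl A (Uniform-ren A r (u x))
  renVal-eval (lam t) u r r′ uv uw q =
    eval-cong t (UniformEnv-,, (UniformEnv-ren _ u) uv)
                (UniformEnv-,, (UniformEnv-ren r′ (UniformEnv-ren r u)) uw)
                (EqEnv-,, (λ {C} x → EqV-sym C (renVal-renVal C r r′ (Uniform⇒EqV-refl C (u x)))) q)
  renVal-eval {A = B} (app {A} t s) u r =
    EqV-trans B (proj₂ (proj₂ (eval-Uniform t u)) (λ x → x) r _ (eval-Uniform s u))
      (renVal-eval t u r (λ x → x) (Uniform-ren A r (eval-Uniform s u))
                   (eval-Uniform s (UniformEnv-ren r u)) (renVal-eval s u r))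

eval-rename : ∀ {Γ Γ′ Δ A} (t : Tm Γ A) (s : Ren Γ Γ′) {ρ : Env Γ′ Δ} {ρ′ : Env Γ Δ} →
              UniformEnv ρ → UniformEnv ρ′ → (∀ {C} (x : Var Γ C) → EqV C (ρ (s x)) (ρ′ x)) →
              EqV A (eval (rename s t) ρ) (eval t ρ′)
eval-rename (var x)    s u u′ e = e x
eval-rename (lam t)    s u u′ e r uv uw q =
  eval-rename t (liftR s) (UniformEnv-,, (UniformEnv-ren r u) uv) (UniformEnv-,, (UniformEnv-ren r u′) uw)
    λ { here → q ; {C} (there x) → EqV-ren C r (e x) }
eval-rename (app t t′) s u u′ e =
  eval-rename t s u u′ e (λ x → x) (eval-Uniform (rename s t′) u) (eval-Uniform t′ u′)
                                   (eval-rename t′ s u u′ e)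

eval-subst : ∀ {Γ Γ′ Δ A} (t : Tm Γ A) (σ : Sub Γ Γ′) {ρ : Env Γ′ Δ} {ρ′ : Env Γ Δ} →
             UniformEnv ρ → UniformEnv ρ′ → (∀ {C} (x : Var Γ C) → EqV C (eval (σ x) ρ) (ρ′ x)) →
             EqV A (eval (subst σ t) ρ) (eval t ρ′)
eval-subst (var x)    σ u u′ e = e x
eval-subst (lam t)    σ u u′ e r uv uw q =
  eval-subst t (liftS σ) (UniformEnv-,, (UniformEnv-ren r u) uv) (UniformEnv-,, (UniformEnv-ren r u′) uw)
    λ { here → q
      ; {C} (there x) → EqV-trans C
          (eval-rename (σ x) there (UniformEnv-,, (UniformEnv-ren r u) uv) (UniformEnv-ren r u)
                       (EqEnv-refl (UniformEnv-ren r u)))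
          (EqV-trans C (EqV-sym C (renVal-eval (σ x) u r)) (EqV-ren C r (e x))) }
eval-subst (app t t′) σ u u′ e =
  eval-subst t σ u u′ e (λ x → x) (eval-Uniform (subst σ t′) u) (eval-Uniform t′ u′)
                                  (eval-subst t′ σ u u′ e)

eval-βη : ∀ {Γ Δ A} {t t′ : Tm Γ A} → t =βη t′ → {ρ ρ′ : Env Γ Δ} →
          UniformEnv ρ → UniformEnv ρ′ → EqEnv ρ ρ′ → EqV A (eval t ρ) (eval t′ ρ′)
eval-βη {t = t} ≈refl u u′ e = eval-cong t u u′ e
eval-βη {A = A} (≈sym p) u u′ e = EqV-sym A (eval-βη p u′ u (λ {C} x → EqV-sym C (e x)))
eval-βη {A = A} (≈trans p q) u u′ e = EqV-trans A (eval-βη p u u′ e) (eval-βη q u′ u′ (EqEnv-refl u′))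
eval-βη (≈lam p) u u′ e r uv uw q =
  eval-βη p (UniformEnv-,, (UniformEnv-ren r u) uv) (UniformEnv-,, (UniformEnv-ren r u′) uw)
            (EqEnv-,, (EqEnv-ren r e) q)
eval-βη (≈app {u = s} {u′ = s′} p q) u u′ e =
  eval-βη p u u′ e (λ x → x) (eval-Uniform s u) (eval-Uniform s′ u′) (eval-βη q u u′ e)
eval-βη {A = B} (β {A} t s) u u′ e =
  EqV-sym B (eval-subst t (sub₀ s) u′ (UniformEnv-,, (UniformEnv-ren (λ x → x) u) (eval-Uniform s u))
    λ { here → EqV-sym A (eval-cong s u u′ e)
      ; {C} (there x) → EqV-sym C (renVal-id C (e x)) })
eval-βη (η t) u u′ e r uv uw q =
  EqV-trans _ (renVal-eval t u r (λ x → x) uv uw q)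
    (EqV-trans _ (eval-cong t (UniformEnv-ren r u) (UniformEnv-ren r u′) (EqEnv-ren r e)
                            (λ x → x) uw uw (Uniform⇒EqV-refl _ uw))
      (EqV-sym _ (eval-rename t there (UniformEnv-,, (UniformEnv-ren r u′) uw) (UniformEnv-ren r u′)
                              (EqEnv-refl (UniformEnv-ren r u′))
                              (λ x → x) uw uw (Uniform⇒EqV-refl _ uw))))

UniformEnv-id : ∀ {Γ} → UniformEnv (idEnv {Γ})
UniformEnv-id {A = A} x = Uniform-reflect A (var x)

nf-βη : ∀ {Γ A} {t t′ : Tm Γ A} → t =βη t′ → nf t ≡ nf t′
nf-βη {A = A} p = reify-cong A (eval-βη p UniformEnv-id UniformEnv-id (λ {C} x → reflect-cong C refl))

-- Soundness, via a glueing relation between terms and values.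

Tracks : ∀ {Γ} A → Tm Γ A → Val Γ A → Set
Tracks ι           t n = t =βη embNe n
Tracks {Γ} (A ⇒ B) t f =
  ∀ {Δ} (r : Ren Γ Δ) {u v} → Tracks A u v → Tracks B (app (rename r t) u) (f r v)

Tracks-βη : ∀ {Γ} A {t t′ : Tm Γ A} {v} → t =βη t′ → Tracks A t v → Tracks A t′ v
Tracks-βη ι       p h     = ≈trans (≈sym p) h
Tracks-βη (A ⇒ B) p h r x = Tracks-βη B (≈app (rename-βη r p) ≈refl) (h r x)

Tracks-ren : ∀ {Γ Δ} A (r : Ren Γ Δ) {t v} → Tracks A t v → Tracks A (rename r t) (renVal A r v)
Tracks-ren ι       r {v = n} h = ≈trans (rename-βη r h) (≡⇒=βη (rename-embNe r n))
Tracks-ren (A ⇒ B) r {t} h r′ {u} x =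
  Tracks-βη B (≡⇒=βη (cong (λ s → app s u) (sym (rename-rename r r′ t)))) (h _ x)

mutual
  reflect-Tracks : ∀ {Γ} A (n : Ne Γ A) → Tracks A (embNe n) (reflect A n)
  reflect-Tracks ι       n = ≈refl
  reflect-Tracks (A ⇒ B) n r x =
    Tracks-βη B (≈app (≡⇒=βη (sym (rename-embNe r n))) (≈sym (reify-Tracks A x)))
                (reflect-Tracks B (app (renNe r n) _))

  reify-Tracks : ∀ {Γ} A {t v} → Tracks A t v → t =βη embNf {Γ} (reify A v)
  reify-Tracks ι       h = h
  reify-Tracks (A ⇒ B) {t} h = ≈trans (η t) (≈lam (reify-Tracks B (h there (reflect-Tracks A (var here)))))

fundamental : ∀ {Γ Δ A} (t : Tm Γ A) (σ : Sub Γ Δ) (ρ : Env Γ Δ) →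
              (∀ {C} (x : Var Γ C) → Tracks C (σ x) (ρ x)) → Tracks A (subst σ t) (eval t ρ)
fundamental (var x) σ ρ h = h x
fundamental {A = B} (app t s) σ ρ h =
  Tracks-βη B (≈app (≡⇒=βη (rename-id (λ _ → refl) _)) ≈refl)
              (fundamental t σ ρ h (λ x → x) (fundamental s σ ρ h))
fundamental {A = A ⇒ B} (lam t) σ ρ h r {u} {v} x =
  Tracks-βη B (≈sym (≈trans (β _ u) (≡⇒=βη body-subst))) (fundamental t σ′ _ h′)
  where
  σ′ : Sub (A ∷ _) _
  σ′ here      = u
  σ′ (there y) = rename r (σ y)

  h′ : ∀ {C} (y : Var (A ∷ _) C) → Tracks C (σ′ y) ((renEnv r ρ ,, v) y)
  h′ here          = x
  h′ {C} (there y) = Tracks-ren C r (h y)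

  open ≡-Reasoning
  body-subst : subst (sub₀ u) (rename (liftR r) (subst (liftS σ) t)) ≡ subst σ′ t
  body-subst = begin
    subst (sub₀ u) (rename (liftR r) (subst (liftS σ) t))
      ≡⟨ cong (subst (sub₀ u)) (rename-subst (liftS σ) (liftR r) t) ⟩
    subst (sub₀ u) (subst (λ y → rename (liftR r) (liftS σ y)) t)
      ≡⟨ subst-subst _ (sub₀ u) t ⟩
    subst (λ y → subst (sub₀ u) (rename (liftR r) (liftS σ y))) t
      ≡⟨ subst-cong (λ { here → refl
                       ; (there y) → trans (cong (subst (sub₀ u)) (rename-weaken r (σ y)))
                                           (subst-sub₀-weaken u (rename r (σ y))) }) t ⟩
    subst σ′ t ∎

nf-sound : ∀ {Γ A} (t : Tm Γ A) → t =βη embNf (nf t)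
nf-sound {A = A} t =
  reify-Tracks A (Tracks-βη A (≡⇒=βη (subst-id (λ _ → refl) t))
                              (fundamental t var idEnv (λ {C} x → reflect-Tracks C (var x))))

-- Injectivity of heads

data NfArgs (Γ : Ctx) : List Ty → Set where
  []  : NfArgs Γ []
  _∷_ : ∀ {A As} → Nf Γ A → NfArgs Γ As → NfArgs Γ (A ∷ As)

∷-injective : ∀ {Γ A As} {m n : Nf Γ A} {ms ns : NfArgs Γ As} →
              _≡_ {A = NfArgs Γ (A ∷ As)} (m ∷ ms) (n ∷ ns) → m ≡ n × ms ≡ ns
∷-injective refl = refl , refl

nfArgs : ∀ {Γ As} → Args Γ As → NfArgs Γ As
nfArgs []       = []
nfArgs (M ∷ Ms) = nf M ∷ nfArgs Ms

nfArgs-injective : ∀ {Γ As} (Ms Ns : Args Γ As) → nfArgs Ms ≡ nfArgs Ns → Ms =βη* Ns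
nfArgs-injective []       []       p = []
nfArgs-injective (M ∷ Ms) (N ∷ Ns) p with ∷-injective p
... | nfM≡nfN , p′ =
  ≈trans (nf-sound M) (≈trans (≡⇒=βη (cong embNf nfM≡nfN)) (≈sym (nf-sound N)))
  ∷ nfArgs-injective Ms Ns p′

Spine : Ctx → Set
Spine Γ = Σ Ty (λ A → Var Γ A × NfArgs Γ (args A))

spine : ∀ {Γ B} → Ne Γ B → NfArgs Γ (args B) → Spine Γ
spine (var x)   ms = _ , x , ms
spine (app n m) ms = spine n (m ∷ ms)

spine-eval-apps : ∀ {Γ} C (t : Tm Γ C) (n : Ne Γ C) → eval t idEnv ≡ reflect C n →
                  (Ms : Args Γ (args C)) → spine (eval (apps t Ms) idEnv) [] ≡ spine n (nfArgs Ms)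
spine-eval-apps ι       t n t≡n []       = cong (λ n′ → spine n′ []) t≡n
spine-eval-apps (A ⇒ B) t n t≡n (M ∷ Ms) =
  spine-eval-apps B (app t M) (app n (nf M)) (begin
    eval t idEnv (λ x → x) (eval M idEnv)            ≡⟨ cong (λ f → f (λ x → x) (eval M idEnv)) t≡n ⟩
    reflect B (app (renNe (λ x → x) n) (nf M))
      ≡⟨ cong (λ n′ → reflect B (app n′ (nf M))) (renNe-id (λ _ → refl) n) ⟩
    reflect B (app n (nf M))                        ∎) Ms
  where open ≡-Reasoning

spine-nf-apps-var : ∀ {Γ A} (a : Var Γ A) (Ms : Args Γ (args A)) →
                    spine (eval (apps (var a) Ms) idEnv) [] ≡ (A , a , nfArgs Ms)
spine-nf-apps-var {A = A} a = spine-eval-apps A (var a) (var a) refl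

apps-var-injective : ∀ {Γ A B} (a : Var Γ A) (b : Var Γ B) (Ms : Args Γ (args A)) (Ns : Args Γ (args B)) →
                     apps (var a) Ms =βη apps (var b) Ns → SameSpine a Ms b Ns
apps-var-injective a b Ms Ns p =
  same-spine refl refl (trans (sym (spine-nf-apps-var a Ms))
                         (trans (cong (λ { (ne n) → spine n [] }) (nf-βη p)) (spine-nf-apps-var b Ns)))
  where
  same-spine : ∀ {ms ns} → ms ≡ nfArgs Ms → ns ≡ nfArgs Ns →
               _≡_ {A = Spine _} (_ , a , ms) (_ , b , ns) → SameSpine a Ms b Ns
  same-spine ms≡ ns≡ refl = same (nfArgs-injective Ms Ns (trans (sym ms≡) ns≡))

injectˡ : ∀ {Ξ Φ A} → Var Ξ A → Var (Ξ ++ Φ) A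
injectˡ here      = here
injectˡ (there x) = there (injectˡ x)

injectʳ : ∀ Ξ {Φ A} → Var Φ A → Var (Ξ ++ Φ) A
injectʳ []      y = y
injectʳ (X ∷ Ξ) y = there (injectʳ Ξ y)

++-elim : ∀ Ξ {Φ} {F : Ty → Set} → (∀ {C} → Var Ξ C → F C) → (∀ {C} → Var Φ C → F C) →
          ∀ {C} → Var (Ξ ++ Φ) C → F C
++-elim []      f g v         = g v
++-elim (X ∷ Ξ) f g here      = f here
++-elim (X ∷ Ξ) f g (there v) = ++-elim Ξ (λ w → f (there w)) g v

++-elim-injectˡ : ∀ Ξ {Φ F} (f : ∀ {C} → Var Ξ C → F C) (g : ∀ {C} → Var Φ C → F C) {C} (x : Var Ξ C) →
                  ++-elim Ξ {F = F} f g (injectˡ x) ≡ f x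
++-elim-injectˡ (X ∷ Ξ) f g here      = refl
++-elim-injectˡ (X ∷ Ξ) f g (there x) = ++-elim-injectˡ Ξ (λ w → f (there w)) g x

++-elim-injectʳ : ∀ Ξ {Φ F} (f : ∀ {C} → Var Ξ C → F C) (g : ∀ {C} → Var Φ C → F C) {C} (y : Var Φ C) →
                  ++-elim Ξ {F = F} f g (injectʳ Ξ y) ≡ g y
++-elim-injectʳ []      f g y = refl
++-elim-injectʳ (X ∷ Ξ) f g y = ++-elim-injectʳ Ξ (λ w → f (there w)) g y

data Split (Ξ Φ : Ctx) {A} : Var (Ξ ++ Φ) A → Set where
  inˡ : (x : Var Ξ A) → Split Ξ Φ (injectˡ x)
  inʳ : (y : Var Φ A) → Split Ξ Φ (injectʳ Ξ y)

split : ∀ Ξ {Φ A} (v : Var (Ξ ++ Φ) A) → Split Ξ Φ v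
split []      v         = inʳ v
split (X ∷ Ξ) here      = inˡ here
split (X ∷ Ξ) (there v) with split Ξ v
... | inˡ x = inˡ (there x)
... | inʳ y = inʳ y

-- Xs ⊳ Ψ is Ψ extended by the variables Xs in the order in which nested λs bind them,
-- i.e. reverse Xs ++ Ψ.

infixr 5 _⊳_
_⊳_ : List Ty → Ctx → Ctx
[]       ⊳ Ψ = Ψ
(X ∷ Xs) ⊳ Ψ = Xs ⊳ (X ∷ Ψ)

weaken⊳ : ∀ Xs {Ψ} → Ren Ψ (Xs ⊳ Ψ)
weaken⊳ []       v = v
weaken⊳ (X ∷ Xs) v = weaken⊳ Xs (there v)

var⊳ : ∀ Xs {Ψ} → Ren Xs (Xs ⊳ Ψ)
var⊳ (X ∷ Xs) here      = weaken⊳ Xs here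
var⊳ (X ∷ Xs) (there v) = var⊳ Xs v

∷-elim : ∀ {Ψ X} {F : Ty → Set} → F X → (∀ {C} → Var Ψ C → F C) → ∀ {C} → Var (X ∷ Ψ) C → F C
∷-elim u f here      = u
∷-elim u f (there v) = f v

⊳-elim : ∀ Xs {Ψ} {F : Ty → Set} → (∀ {C} → Var Ψ C → F C) → (∀ {C} → Var Xs C → F C) →
         ∀ {C} → Var (Xs ⊳ Ψ) C → F C
⊳-elim []       ψ ξ v = ψ v
⊳-elim (X ∷ Xs) {F = F} ψ ξ v = ⊳-elim Xs {F = F} (∷-elim {F = F} (ξ here) ψ) (λ w → ξ (there w)) v

⊳-elim-weaken⊳ : ∀ Xs {Ψ F} (ψ : ∀ {C} → Var Ψ C → F C) (ξ : ∀ {C} → Var Xs C → F C)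
                 {C} (y : Var Ψ C) →
                 ⊳-elim Xs {F = F} ψ ξ (weaken⊳ Xs y) ≡ ψ y
⊳-elim-weaken⊳ []       ψ ξ y = refl
⊳-elim-weaken⊳ (X ∷ Xs) {F = F} ψ ξ y =
  ⊳-elim-weaken⊳ Xs {F = F} (∷-elim {F = F} (ξ here) ψ) (λ w → ξ (there w)) (there y)

⊳-elim-var⊳ : ∀ Xs {Ψ F} (ψ : ∀ {C} → Var Ψ C → F C) (ξ : ∀ {C} → Var Xs C → F C)
              {C} (v : Var Xs C) →
              ⊳-elim Xs {F = F} ψ ξ (var⊳ Xs v) ≡ ξ v
⊳-elim-var⊳ (X ∷ Xs) {F = F} ψ ξ here      =
  ⊳-elim-weaken⊳ Xs {F = F} (∷-elim {F = F} (ξ here) ψ) (λ w → ξ (there w)) here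
⊳-elim-var⊳ (X ∷ Xs) {F = F} ψ ξ (there v) =
  ⊳-elim-var⊳ Xs {F = F} (∷-elim {F = F} (ξ here) ψ) (λ w → ξ (there w)) v

lookup : ∀ {Ψ As C} → Args Ψ As → Var As C → Tm Ψ C
lookup (M ∷ Ms) here      = M
lookup (M ∷ Ms) (there v) = lookup Ms v

tabulate : ∀ {Ψ} As → (∀ {C} → Var As C → Tm Ψ C) → Args Ψ As
tabulate []       f = []
tabulate (A ∷ As) f = f here ∷ tabulate As (λ v → f (there v))

lookup-tabulate : ∀ {Ψ} As (f : ∀ {C} → Var As C → Tm Ψ C) {C} (v : Var As C) →
                  lookup (tabulate As f) v ≡ f v
lookup-tabulate (A ∷ As) f here      = refl
lookup-tabulate (A ∷ As) f (there v) = lookup-tabulate As (λ w → f (there w)) v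

tabulate-lookup : ∀ {Ψ As} (Ms : Args Ψ As) → tabulate As (lookup Ms) ≡ Ms
tabulate-lookup []       = refl
tabulate-lookup (M ∷ Ms) = cong (M ∷_) (tabulate-lookup Ms)

tabulate-cong : ∀ {Ψ} As {f g : ∀ {C} → Var As C → Tm Ψ C} →
                (∀ {C} (v : Var As C) → f v ≡ g v) → tabulate As f ≡ tabulate As g
tabulate-cong []       h = refl
tabulate-cong (A ∷ As) h = cong₂ _∷_ (h here) (tabulate-cong As (λ v → h (there v)))

Args-≡ : ∀ {Ψ As} {Ms Ns : Args Ψ As} → (∀ {C} (v : Var As C) → lookup Ms v ≡ lookup Ns v) → Ms ≡ Ns
Args-≡ {Ms = Ms} {Ns} h =
  trans (sym (tabulate-lookup Ms)) (trans (tabulate-cong _ h) (tabulate-lookup Ns))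

=βη*-refl : ∀ {Ψ As} (Ms : Args Ψ As) → Ms =βη* Ms
=βη*-refl []       = []
=βη*-refl (M ∷ Ms) = ≈refl ∷ =βη*-refl Ms

lookup-βη : ∀ {Ψ As} {Ms Ns : Args Ψ As} → Ms =βη* Ns → ∀ {C} (v : Var As C) → lookup Ms v =βη lookup Ns v
lookup-βη (p ∷ ps) here      = p
lookup-βη (p ∷ ps) (there v) = lookup-βη ps v

substArgs : ∀ {Γ Δ As} → Sub Γ Δ → Args Γ As → Args Δ As
substArgs σ []       = []
substArgs σ (M ∷ Ms) = subst σ M ∷ substArgs σ Ms

renArgs : ∀ {Γ Δ As} → Ren Γ Δ → Args Γ As → Args Δ As
renArgs r []       = []
renArgs r (M ∷ Ms) = rename r M ∷ renArgs r Ms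

lookup-substArgs : ∀ {Γ Δ As} (σ : Sub Γ Δ) (Ms : Args Γ As) {C} (v : Var As C) →
                   lookup (substArgs σ Ms) v ≡ subst σ (lookup Ms v)
lookup-substArgs σ (M ∷ Ms) here      = refl
lookup-substArgs σ (M ∷ Ms) (there v) = lookup-substArgs σ Ms v

lookup-renArgs : ∀ {Γ Δ As} (r : Ren Γ Δ) (Ms : Args Γ As) {C} (v : Var As C) →
                 lookup (renArgs r Ms) v ≡ rename r (lookup Ms v)
lookup-renArgs r (M ∷ Ms) here      = refl
lookup-renArgs r (M ∷ Ms) (there v) = lookup-renArgs r Ms v

subst-apps : ∀ {Γ Δ A} (σ : Sub Γ Δ) (t : Tm Γ A) (Ms : Args Γ (args A)) →
             subst σ (apps t Ms) ≡ apps (subst σ t) (substArgs σ Ms)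
subst-apps {A = ι}     σ t []       = refl
subst-apps {A = A ⇒ B} σ t (M ∷ Ms) = subst-apps σ (app t M) Ms

rename-apps : ∀ {Γ Δ A} (r : Ren Γ Δ) (t : Tm Γ A) (Ms : Args Γ (args A)) →
              rename r (apps t Ms) ≡ apps (rename r t) (renArgs r Ms)
rename-apps {A = ι}     r t []       = refl
rename-apps {A = A ⇒ B} r t (M ∷ Ms) = rename-apps r (app t M) Ms

apps-βη : ∀ {Γ A} {t t′ : Tm Γ A} {Ms Ns : Args Γ (args A)} →
          t =βη t′ → Ms =βη* Ns → apps t Ms =βη apps t′ Ns
apps-βη {A = ι}     p []       = p
apps-βη {A = A ⇒ B} p (q ∷ qs) = apps-βη (≈app p q) qs

renArgs-renArgs : ∀ {Γ Δ Ψ As} (r : Ren Γ Δ) (r′ : Ren Δ Ψ) (Ms : Args Γ As) →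
                  renArgs r′ (renArgs r Ms) ≡ renArgs (λ x → r′ (r x)) Ms
renArgs-renArgs r r′ []       = refl
renArgs-renArgs r r′ (M ∷ Ms) = cong₂ _∷_ (rename-rename r r′ M) (renArgs-renArgs r r′ Ms)

renArgs-cong : ∀ {Γ Δ As} {r s : Ren Γ Δ} → r ≗ʳ s → (Ms : Args Γ As) → renArgs r Ms ≡ renArgs s Ms
renArgs-cong e []       = refl
renArgs-cong e (M ∷ Ms) = cong₂ _∷_ (rename-cong e M) (renArgs-cong e Ms)

vars⊳ : ∀ Xs {Ψ} → Args (Xs ⊳ Ψ) Xs
vars⊳ Xs = tabulate Xs (λ v → var (var⊳ Xs v))

lookup-vars⊳ : ∀ Xs {Ψ C} (v : Var Xs C) → lookup (vars⊳ Xs {Ψ}) v ≡ var (var⊳ Xs v)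
lookup-vars⊳ Xs = lookup-tabulate Xs (λ v → var (var⊳ Xs v))

lams : ∀ T {Γ} → Tm (args T ⊳ Γ) ι → Tm Γ T
lams ι       b = b
lams (X ⇒ T) b = lam (lams T b)

extend⊳ : ∀ {Γ Ψ} Xs → Sub Γ Ψ → Args Ψ Xs → Sub (Xs ⊳ Γ) Ψ
extend⊳ Xs σ Ms = ⊳-elim Xs {F = Tm _} σ (lookup Ms)

extend⊳-weaken⊳ : ∀ {Γ Ψ} Xs (σ : Sub Γ Ψ) (Ms : Args Ψ Xs) {C} (y : Var Γ C) →
                  extend⊳ Xs σ Ms (weaken⊳ Xs y) ≡ σ y
extend⊳-weaken⊳ Xs σ Ms = ⊳-elim-weaken⊳ Xs {F = Tm _} σ (lookup Ms)

extend⊳-var⊳ : ∀ {Γ Ψ} Xs (σ : Sub Γ Ψ) (Ms : Args Ψ Xs) {C} (v : Var Xs C) →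
               extend⊳ Xs σ Ms (var⊳ Xs v) ≡ lookup Ms v
extend⊳-var⊳ Xs σ Ms = ⊳-elim-var⊳ Xs {F = Tm _} σ (lookup Ms)

lift⊳ : ∀ Xs {Γ Ψ} → Sub Γ Ψ → Sub (Xs ⊳ Γ) (Xs ⊳ Ψ)
lift⊳ Xs σ = extend⊳ Xs (λ x → rename (weaken⊳ Xs) (σ x)) (vars⊳ Xs)

apps-lams : ∀ T {Γ Ψ} (b : Tm (args T ⊳ Γ) ι) (σ : Sub Γ Ψ) (Ms : Args Ψ (args T)) →
            apps (subst σ (lams T b)) Ms =βη subst (extend⊳ (args T) σ Ms) b
apps-lams ι       b σ []       = ≈refl
apps-lams (X ⇒ T) b σ (M ∷ Ms) =
  ≈trans (apps-βη (≈trans (β _ M) (≡⇒=βη one-step)) (=βη*-refl Ms))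
         (apps-lams T b (∷-elim {F = Tm _} M σ) Ms)
  where
  one-step : subst (sub₀ M) (subst (liftS σ) (lams T b)) ≡ subst (∷-elim {F = Tm _} M σ) (lams T b)
  one-step = trans (subst-subst (liftS σ) (sub₀ M) (lams T b))
                   (subst-cong (λ { here → refl ; (there y) → subst-sub₀-weaken M (σ y) }) (lams T b))

inhabit : ∀ {Ψ} → (∀ {Ψ′} → Ren Ψ Ψ′ → Tm Ψ′ ι) → ∀ C → Tm Ψ C
inhabit base C = lams C (base (weaken⊳ (args C)))

placeAt : ∀ {Ψ C} As → Var As C → Tm Ψ C → (∀ B → Tm Ψ B) → Args Ψ As
placeAt (B ∷ As) here      u d = u ∷ tabulate As (λ {E} _ → d E)
placeAt (B ∷ As) (there v) u d = d B ∷ placeAt As v u d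

lookup-placeAt : ∀ {Ψ C} As (v : Var As C) (u : Tm Ψ C) d → lookup (placeAt As v u d) v ≡ u
lookup-placeAt (B ∷ As) here      u d = refl
lookup-placeAt (B ∷ As) (there v) u d = lookup-placeAt As v u d

-- Applying both sides to fresh variables and β-reducing.
lams-injective : ∀ C {Γ Γ′ Ψ} (σ : Sub Γ Ψ) (σ′ : Sub Γ′ Ψ)
                 (b : Tm (args C ⊳ Γ) ι) (b′ : Tm (args C ⊳ Γ′) ι) →
                 subst σ (lams C b) =βη subst σ′ (lams C b′) →
                 subst (lift⊳ (args C) σ) b =βη subst (lift⊳ (args C) σ′) b′
lams-injective C σ σ′ b b′ p =
  ≈trans (≈sym (apps-lams C b _ (vars⊳ (args C))))
    (≈trans (apps-βη weakened (=βη*-refl (vars⊳ (args C))))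
            (apps-lams C b′ _ (vars⊳ (args C))))
  where
  w = weaken⊳ (args C)
  weakened : subst (λ x → rename w (σ x)) (lams C b) =βη subst (λ x → rename w (σ′ x)) (lams C b′)
  weakened = ≈trans (≡⇒=βη (sym (rename-subst σ w (lams C b))))
               (≈trans (rename-βη w p) (≡⇒=βη (rename-subst σ′ w (lams C b′))))

SameSpine-there⁻ : ∀ {Ψ Φ A B X} {a : Var Ψ A} {b : Var Ψ B} {Ms : Args Φ (args A)} {Ns} →
                   SameSpine (there {B = X} a) Ms (there b) Ns → SameSpine a Ms b Ns
SameSpine-there⁻ (same q) = same q

SameSpine-there : ∀ {Ψ Φ A B X} {a : Var Ψ A} {b : Var Ψ B} {Ms : Args Φ (args A)} {Ns} →
                  SameSpine a Ms b Ns → SameSpine (there {B = X} a) Ms (there b) Ns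
SameSpine-there (same q) = same q

SameSpine-injectˡ : ∀ {Ξ Φ Φ′ Ψ A B} (x : Var Ξ A) (y : Var Ξ B) {Ms : Args Ψ (args A)} {Ns} →
                    SameSpine (injectˡ {Φ = Φ} x) Ms (injectˡ y) Ns →
                    SameSpine (injectˡ {Φ = Φ′} x) Ms (injectˡ y) Ns
SameSpine-injectˡ here      here      (same q) = same q
SameSpine-injectˡ (there x) (there y) s        = SameSpine-there (SameSpine-injectˡ x y (SameSpine-there⁻ s))

SameSpine-injectʳ⁻ : ∀ Ξ {Φ Ψ A B} {a : Var Φ A} {b : Var Φ B} {Ms : Args Ψ (args A)} {Ns} →
                     SameSpine (injectʳ Ξ a) Ms (injectʳ Ξ b) Ns → SameSpine a Ms b Ns
SameSpine-injectʳ⁻ []      s = s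
SameSpine-injectʳ⁻ (X ∷ Ξ) s = SameSpine-injectʳ⁻ Ξ (SameSpine-there⁻ s)

SameSpine-injectˡ-injectʳ : ∀ Ξ {Φ Ψ A B} (x : Var Ξ A) (y : Var Φ B) {Ms : Args Ψ (args A)} {Ns} →
                            SameSpine (injectˡ x) Ms (injectʳ Ξ y) Ns → ⊥
SameSpine-injectˡ-injectʳ (X ∷ Ξ) here      y ()
SameSpine-injectˡ-injectʳ (X ∷ Ξ) (there x) y s = SameSpine-injectˡ-injectʳ Ξ x y (SameSpine-there⁻ s)

SameSpine-args : ∀ {Ψ Φ A} {a : Var Ψ A} {Ms Ns : Args Φ (args A)} → SameSpine a Ms a Ns → Ms =βη* Ns
SameSpine-args (same q) = q

extSub-injectˡ : ∀ Ξ {Θ Δ A} (σ : Sub Θ Δ) (x : Var Ξ A) → extSub Ξ σ (injectˡ x) ≡ var (injectˡ x)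
extSub-injectˡ (X ∷ Ξ) σ here      = refl
extSub-injectˡ (X ∷ Ξ) σ (there x) = cong weaken (extSub-injectˡ Ξ σ x)

extSub-injectʳ : ∀ Ξ {Θ Δ A} (σ : Sub Θ Δ) (y : Var Θ A) →
                 extSub Ξ σ (injectʳ Ξ y) ≡ rename (injectʳ Ξ) (σ y)
extSub-injectʳ []      σ y = sym (rename-id (λ _ → refl) (σ y))
extSub-injectʳ (X ∷ Ξ) σ y = trans (cong weaken (extSub-injectʳ Ξ σ y)) (rename-rename (injectʳ Ξ) there (σ y))

rename-βη-reflect : ∀ {Γ Δ A} (r : Ren Γ Δ) (s : Sub Δ Γ) → (∀ {C} (x : Var Γ C) → s (r x) ≡ var x) →
                    {M N : Tm Γ A} → rename r M =βη rename r N → M =βη N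
rename-βη-reflect r s sr≡var {M} {N} p =
  ≈trans (≡⇒=βη (sym (retract M))) (≈trans (subst-βη s p) (≡⇒=βη (retract N)))
  where
  retract : ∀ {A} (M : Tm _ A) → subst s (rename r M) ≡ M
  retract M = trans (subst-rename r s M) (subst-id sr≡var M)

renArgs-βη*-reflect : ∀ {Γ Δ As} (r : Ren Γ Δ) (s : Sub Δ Γ) → (∀ {C} (x : Var Γ C) → s (r x) ≡ var x) →
                      (Ms Ns : Args Γ As) → renArgs r Ms =βη* renArgs r Ns → Ms =βη* Ns
renArgs-βη*-reflect r s sr≡var []       []       []       = []
renArgs-βη*-reflect r s sr≡var (M ∷ Ms) (N ∷ Ns) (p ∷ ps) =
  rename-βη-reflect r s sr≡var p ∷ renArgs-βη*-reflect r s sr≡var Ms Ns ps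

-- Atomic reductions along derivatives

Filler : Ctx → Ctx → Set
Filler Γ Θ = ∀ {T} → Var Θ T → ∀ {Ψ} → Ren Γ Ψ → Args Ψ (args T) → Tm Ψ ι

module DirectDerivative (Γ : Ctx) {Θ A Aₖ} (f : Var Γ A) (k : Var (args A) Aₖ) (fill : Filler Γ Θ)
                        (ϱ : Sub Θ (Γ ++ args Aₖ)) (ϱ-atomic : IsAtomic ϱ) where

  D : Ctx
  D = args Aₖ

  embedBody : ∀ Xs → Ren (Γ ++ D) (D ⊳ (Xs ⊳ Γ))
  embedBody Xs = ++-elim Γ {F = Var _} (λ x → weaken⊳ D (weaken⊳ Xs x)) (var⊳ D)

  kthBody : ∀ {T} → Var Θ T → Tm (D ⊳ (args T ⊳ Γ)) ι
  kthBody {T} t = apps (rename (embedBody (args T)) (ϱ t)) (renArgs (weaken⊳ D) (vars⊳ (args T)))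

  dummy : ∀ {T} → Var Θ T → ∀ C → Tm (args T ⊳ Γ) C
  dummy {T} t = inhabit (λ g → fill t (λ x → g (weaken⊳ (args T) x)) (renArgs g (vars⊳ (args T))))

  fArgs : ∀ {T} → Var Θ T → Args (args T ⊳ Γ) (args A)
  fArgs {T} t = placeAt (args A) k (lams Aₖ (kthBody t)) (dummy t)

  σ : Sub Θ Γ
  σ {T} t = lams T (apps (var (weaken⊳ (args T) f)) (fArgs t))

  module _ (Ξ : Ctx) where
    open ≡-Reasoning

    instantiate : ∀ {T} → Args (Ξ ++ Γ) (args T) → Sub (args T ⊳ Γ) (Ξ ++ Γ)
    instantiate {T} Ms = extend⊳ (args T) (λ x → var (injectʳ Ξ x)) Ms

    fArgsAt : ∀ {T} → Var Θ T → Args (Ξ ++ Γ) (args T) → Args (Ξ ++ Γ) (args A)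
    fArgsAt t Ms = substArgs (instantiate Ms) (fArgs t)

    σ-unfoldˡ : ∀ {C} (x : Var Ξ C) (Ms : Args (Ξ ++ Γ) (args C)) →
                apps (extSub Ξ σ (injectˡ x)) Ms =βη apps (var (injectˡ x)) Ms
    σ-unfoldˡ x Ms = ≡⇒=βη (cong (λ s → apps s Ms) (extSub-injectˡ Ξ σ x))

    σ-unfold : ∀ {T} (t : Var Θ T) (Ms : Args (Ξ ++ Γ) (args T)) →
               apps (extSub Ξ σ (injectʳ Ξ t)) Ms =βη apps (var (injectʳ Ξ f)) (fArgsAt t Ms)
    σ-unfold {T} t Ms =
      ≈trans (≡⇒=βη (cong (λ s → apps s Ms)
                          (trans (extSub-injectʳ Ξ σ t) (rename-as-subst (injectʳ Ξ) (σ t)))))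
        (≈trans (apps-lams T _ (λ x → var (injectʳ Ξ x)) Ms)
          (≡⇒=βη (trans (subst-apps (instantiate Ms) (var (weaken⊳ (args T) f)) (fArgs t))
                        (cong (λ s → apps s (fArgsAt t Ms))
                              (extend⊳-weaken⊳ (args T) (λ x → var (injectʳ Ξ x)) Ms f)))))

    kth-fArgsAt : ∀ {T} (t : Var Θ T) (Ms : Args (Ξ ++ Γ) (args T)) →
                  lookup (fArgsAt t Ms) k ≡ subst (instantiate Ms) (lams Aₖ (kthBody t))
    kth-fArgsAt t Ms =
      trans (lookup-substArgs (instantiate Ms) (fArgs t) k)
            (cong (subst (instantiate Ms)) (lookup-placeAt (args A) k _ _))

    body : Ren (Γ ++ D) (D ⊳ (Ξ ++ Γ))
    body = ++-elim Γ {F = Var _} (λ x → weaken⊳ D (injectʳ Ξ x)) (var⊳ D)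

    lift⊳-instantiate-embedBody : ∀ {T} (Ms : Args (Ξ ++ Γ) (args T)) {C} (v : Var (Γ ++ D) C) →
                                  lift⊳ D (instantiate Ms) (embedBody (args T) v) ≡ var (body v)
    lift⊳-instantiate-embedBody {T} Ms v with split Γ v
    ... | inˡ x = begin
      lift⊳ D (instantiate Ms) (embedBody (args T) (injectˡ x))
        ≡⟨ cong (lift⊳ D (instantiate Ms)) (++-elim-injectˡ Γ {F = Var _} _ (var⊳ D) x) ⟩
      lift⊳ D (instantiate Ms) (weaken⊳ D (weaken⊳ (args T) x))
        ≡⟨ extend⊳-weaken⊳ D _ (vars⊳ D) _ ⟩
      rename (weaken⊳ D) (instantiate Ms (weaken⊳ (args T) x))
        ≡⟨ cong (rename (weaken⊳ D)) (extend⊳-weaken⊳ (args T) _ Ms x) ⟩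
      var (weaken⊳ D (injectʳ Ξ x))
        ≡⟨ cong var (sym (++-elim-injectˡ Γ {F = Var _} _ (var⊳ D) x)) ⟩
      var (body (injectˡ x)) ∎
    ... | inʳ d = begin
      lift⊳ D (instantiate Ms) (embedBody (args T) (injectʳ Γ d))
        ≡⟨ cong (lift⊳ D (instantiate Ms)) (++-elim-injectʳ Γ {F = Var _} _ (var⊳ D) d) ⟩
      lift⊳ D (instantiate Ms) (var⊳ D d)
        ≡⟨ extend⊳-var⊳ D _ (vars⊳ D) d ⟩
      lookup (vars⊳ D) d
        ≡⟨ lookup-vars⊳ D d ⟩
      var (var⊳ D d)
        ≡⟨ cong var (sym (++-elim-injectʳ Γ {F = Var _} _ (var⊳ D) d)) ⟩
      var (body (injectʳ Γ d)) ∎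

    kthBody-instantiate : ∀ {T} (t : Var Θ T) (Ms : Args (Ξ ++ Γ) (args T)) →
                          subst (lift⊳ D (instantiate Ms)) (kthBody t) ≡
                          apps (rename body (ϱ t)) (renArgs (weaken⊳ D) Ms)
    kthBody-instantiate {T} t Ms =
      trans (subst-apps τ (rename (embedBody (args T)) (ϱ t)) (renArgs (weaken⊳ D) (vars⊳ (args T))))
            (cong₂ apps head (Args-≡ argument))
      where
      τ = lift⊳ D (instantiate Ms)
      head : subst τ (rename (embedBody (args T)) (ϱ t)) ≡ rename body (ϱ t)
      head = trans (subst-rename (embedBody (args T)) τ (ϱ t))
               (trans (subst-cong (lift⊳-instantiate-embedBody Ms) (ϱ t)) (sym (rename-as-subst body (ϱ t))))
      argument : ∀ {C} (i : Var (args T) C) →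
                 lookup (substArgs τ (renArgs (weaken⊳ D) (vars⊳ (args T)))) i ≡ lookup (renArgs (weaken⊳ D) Ms) i
      argument i = begin
        lookup (substArgs τ (renArgs (weaken⊳ D) (vars⊳ (args T)))) i
          ≡⟨ lookup-substArgs τ (renArgs (weaken⊳ D) (vars⊳ (args T))) i ⟩
        subst τ (lookup (renArgs (weaken⊳ D) (vars⊳ (args T))) i)
          ≡⟨ cong (subst τ) (lookup-renArgs (weaken⊳ D) (vars⊳ (args T)) i) ⟩
        subst τ (rename (weaken⊳ D) (lookup (vars⊳ (args T)) i))
          ≡⟨ cong (λ s → subst τ (rename (weaken⊳ D) s)) (lookup-vars⊳ (args T) i) ⟩
        τ (weaken⊳ D (var⊳ (args T) i))
          ≡⟨ extend⊳-weaken⊳ D _ (vars⊳ D) _ ⟩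
        rename (weaken⊳ D) (instantiate Ms (var⊳ (args T) i))
          ≡⟨ cong (rename (weaken⊳ D)) (extend⊳-var⊳ (args T) _ Ms i) ⟩
        rename (weaken⊳ D) (lookup Ms i)
          ≡⟨ sym (lookup-renArgs (weaken⊳ D) Ms i) ⟩
        lookup (renArgs (weaken⊳ D) Ms) i ∎

    weakenD : Ren (Ξ ++ Γ) (Ξ ++ (Γ ++ D))
    weakenD = ++-elim Ξ {F = Var _} injectˡ (λ g → injectʳ Ξ (injectˡ g))

    reorder : Ren (D ⊳ (Ξ ++ Γ)) (Ξ ++ (Γ ++ D))
    reorder = ⊳-elim D {F = Var _} weakenD (λ d → injectʳ Ξ (injectʳ Γ d))

    reorder-weaken⊳ : ∀ {C} (w : Var (Ξ ++ Γ) C) → reorder (weaken⊳ D w) ≡ weakenD w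
    reorder-weaken⊳ = ⊳-elim-weaken⊳ D {F = Var _} weakenD (λ d → injectʳ Ξ (injectʳ Γ d))

    reorder-body : ∀ {C} (v : Var (Γ ++ D) C) → reorder (body v) ≡ injectʳ Ξ v
    reorder-body v with split Γ v
    ... | inˡ x = trans (cong reorder (++-elim-injectˡ Γ {F = Var _} _ (var⊳ D) x))
                    (trans (reorder-weaken⊳ (injectʳ Ξ x)) (++-elim-injectʳ Ξ {F = Var _} injectˡ _ x))
    ... | inʳ d = trans (cong reorder (++-elim-injectʳ Γ {F = Var _} _ (var⊳ D) d))
                    (⊳-elim-var⊳ D {F = Var _} weakenD (λ d → injectʳ Ξ (injectʳ Γ d)) d)

    reorder-kthBody : ∀ {T} (t : Var Θ T) (Ms : Args (Ξ ++ Γ) (args T)) →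
                      rename reorder (apps (rename body (ϱ t)) (renArgs (weaken⊳ D) Ms)) ≡
                      apps (extSub Ξ ϱ (injectʳ Ξ t)) (renArgs weakenD Ms)
    reorder-kthBody t Ms =
      trans (rename-apps reorder (rename body (ϱ t)) (renArgs (weaken⊳ D) Ms))
            (cong₂ apps (trans (rename-rename body reorder (ϱ t))
                          (trans (rename-cong reorder-body (ϱ t)) (sym (extSub-injectʳ Ξ ϱ t))))
                        (trans (renArgs-renArgs (weaken⊳ D) reorder Ms) (renArgs-cong reorder-weaken⊳ Ms)))

    -- The variables of D have no canonical value in Ξ,Γ; the filler for t provides one.
    unweakenD : ∀ {T} → Var Θ T → Args (Ξ ++ Γ) (args T) → Sub (Ξ ++ (Γ ++ D)) (Ξ ++ Γ)
    unweakenD t Ms =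
      ++-elim Ξ {F = Tm _} (λ x → var (injectˡ x))
        (++-elim Γ {F = Tm _} (λ g → var (injectʳ Ξ g))
                              (λ {C} _ → inhabit (λ g → fill t (λ x → g (injectʳ Ξ x)) (renArgs g Ms)) C))

    unweakenD-weakenD : ∀ {T} (t : Var Θ T) (Ms : Args (Ξ ++ Γ) (args T)) {C} (v : Var (Ξ ++ Γ) C) →
                        unweakenD t Ms (weakenD v) ≡ var v
    unweakenD-weakenD t Ms v with split Ξ v
    ... | inˡ x = trans (cong (unweakenD t Ms) (++-elim-injectˡ Ξ {F = Var _} injectˡ _ x))
                        (++-elim-injectˡ Ξ {F = Tm _} (λ x → var (injectˡ x)) _ x)
    ... | inʳ g = trans (cong (unweakenD t Ms) (++-elim-injectʳ Ξ {F = Var _} injectˡ _ g))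
                    (trans (++-elim-injectʳ Ξ {F = Tm _} (λ x → var (injectˡ x)) _ (injectˡ g))
                           (++-elim-injectˡ Γ {F = Tm _} (λ g → var (injectʳ Ξ g)) _ g))

    σ-atomic-on-Θ : ∀ {T S} (t : Var Θ T) (s : Var Θ S)
                    (Ms : Args (Ξ ++ Γ) (args T)) (Ns : Args (Ξ ++ Γ) (args S)) →
                    apps (var (injectʳ Ξ f)) (fArgsAt t Ms) =βη apps (var (injectʳ Ξ f)) (fArgsAt s Ns) →
                    SameSpine (injectʳ Ξ t) Ms (injectʳ Ξ s) Ns
    σ-atomic-on-Θ t s Ms Ns p
      with SameSpine-injectʳ⁻ Ξ (ϱ-atomic Ξ (injectʳ Ξ t) (injectʳ Ξ s)
                                          (renArgs weakenD Ms) (renArgs weakenD Ns) ϱ-sides)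
      where
      kth-arguments : subst (instantiate Ms) (lams Aₖ (kthBody t)) =βη
                      subst (instantiate Ns) (lams Aₖ (kthBody s))
      kth-arguments =
        ≈trans (≡⇒=βη (sym (kth-fArgsAt t Ms)))
          (≈trans (lookup-βη (SameSpine-args (apps-var-injective _ _ _ _ p)) k) (≡⇒=βη (kth-fArgsAt s Ns)))
      bodies : apps (rename body (ϱ t)) (renArgs (weaken⊳ D) Ms) =βη
               apps (rename body (ϱ s)) (renArgs (weaken⊳ D) Ns)
      bodies =
        ≈trans (≡⇒=βη (sym (kthBody-instantiate t Ms)))
          (≈trans (lams-injective Aₖ _ _ _ _ kth-arguments) (≡⇒=βη (kthBody-instantiate s Ns)))
      ϱ-sides : apps (extSub Ξ ϱ (injectʳ Ξ t)) (renArgs weakenD Ms) =βη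
                apps (extSub Ξ ϱ (injectʳ Ξ s)) (renArgs weakenD Ns)
      ϱ-sides =
        ≈trans (≡⇒=βη (sym (reorder-kthBody t Ms)))
          (≈trans (rename-βη reorder bodies) (≡⇒=βη (reorder-kthBody s Ns)))
    ... | same q = same (renArgs-βη*-reflect weakenD (unweakenD t Ms) (unweakenD-weakenD t Ms) Ms Ns q)

  σ-atomic : IsAtomic σ
  σ-atomic Ξ a b Ms Ns p with split Ξ a | split Ξ b
  ... | inˡ x | inˡ y =
    SameSpine-injectˡ x y (apps-var-injective (injectˡ x) (injectˡ y) Ms Ns
      (≈trans (≈sym (σ-unfoldˡ Ξ x Ms)) (≈trans p (σ-unfoldˡ Ξ y Ns))))
  ... | inˡ x | inʳ t = ⊥-elim (SameSpine-injectˡ-injectʳ Ξ x f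
    (apps-var-injective (injectˡ x) (injectʳ Ξ f) Ms (fArgsAt Ξ t Ns)
      (≈trans (≈sym (σ-unfoldˡ Ξ x Ms)) (≈trans p (σ-unfold Ξ t Ns)))))
  ... | inʳ t | inˡ y = ⊥-elim (SameSpine-injectˡ-injectʳ Ξ y f
    (apps-var-injective (injectˡ y) (injectʳ Ξ f) Ns (fArgsAt Ξ t Ms)
      (≈trans (≈sym (σ-unfoldˡ Ξ y Ns)) (≈trans (≈sym p) (σ-unfold Ξ t Ms)))))
  ... | inʳ t | inʳ s =
    σ-atomic-on-Θ Ξ t s Ms Ns (≈trans (≈sym (σ-unfold Ξ t Ms)) (≈trans p (σ-unfold Ξ s Ns)))

≤ᵃ-direct-derivative : ∀ {Γ Θ A Aₖ} → Filler Γ Θ → Var Γ A → Var (args A) Aₖ →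
                       Θ ≤ᵃ (Γ ++ args Aₖ) → Θ ≤ᵃ Γ
≤ᵃ-direct-derivative {Γ} fill f k (ϱ , ϱ-atomic) = σ , σ-atomic
  where open DirectDerivative Γ f k fill ϱ ϱ-atomic

_++ᴬ_ : ∀ {Ψ Xs Ys} → Args Ψ Xs → Args Ψ Ys → Args Ψ (Xs ++ Ys)
[]       ++ᴬ Ns = Ns
(M ∷ Ms) ++ᴬ Ns = M ∷ (Ms ++ᴬ Ns)

apps[] : ∀ {Ψ} Cs → Tm Ψ [ Cs ] → Args Ψ Cs → Tm Ψ ι
apps[] []       t []       = t
apps[] (C ∷ Cs) t (M ∷ Ms) = apps[] Cs (app t M) Ms

inhabited⇒Filler : ∀ {Γ Θ} → (∀ {T} → Var Θ T → Inhabited [ Γ ++ args T ]) → Filler Γ Θ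
inhabited⇒Filler {Γ} inh {T} t g Ms =
  apps[] (Γ ++ args T) (rename (λ ()) (inh t)) (tabulate Γ (λ v → var (g v)) ++ᴬ Ms)

Filler-ren : ∀ {Γ Δ Θ} → Ren Γ Δ → Filler Γ Θ → Filler Δ Θ
Filler-ren r fill t g = fill t (λ x → g (r x))

derivative-ren : ∀ {Γ Δ} → Derivative Γ Δ → Ren Γ Δ
derivative-ren done         x = x
derivative-ren (step d f k) x = injectˡ (derivative-ren d x)

≤ᵃ-derivative : ∀ {Γ Δ Θ} → Filler Γ Θ → Derivative Γ Δ → Θ ≤ᵃ Δ → Θ ≤ᵃ Γ
≤ᵃ-derivative fill done         Θ≤Δ = Θ≤Δ
≤ᵃ-derivative fill (step d f k) Θ≤Δ =
  ≤ᵃ-derivative fill d (≤ᵃ-direct-derivative (Filler-ren (derivative-ren d) fill) f k Θ≤Δ)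

lemmaL : (Γ Δ Θ : Ctx) → Derivative Γ Δ →
         (∀ {T} → Var Θ T → Inhabited [ Γ ++ args T ]) →
         Θ ≤ᵃ Δ → Θ ≤ᵃ Γ
lemmaL Γ Δ Θ d inh = ≤ᵃ-derivative (inhabited⇒Filler inh) d
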